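{- Let $X$, $Y$ and $Z$ be finite-dimensional vector spaces over $\mathbb{F}_p$ with $\dim Z=k$. Let $(z_1,\dots,z_r)$ be a sequence of elements of $Z$, and for $1\leq i\leq r$ let $\beta_i:X\times Y\to Z$ be a bi-affine map of rank at least $t$. Then if $x_1,\dots,x_r$ are chosen independently and uniformly at random from $X$, the probability that the system of equations $\beta_i(x_i,y)=z_i$ ($1\leq i\leq r$) has exactly $p^{ -rk}|Y|$ solutions $y\in Y$ is at least $1-p^{rk-t}$.
   Context: $p$ is a prime. A bi-affine map is a map affine in each variable separately. Identifying $Z$ with $\mathbb{F}_p^k$, a bi-affine map $\beta:X\times Y\to Z$ has coordinates $\beta_j(x,y)=\gamma_j(x,y)+(\text{affine terms in }x\text{ alone and }y\text{ alone})$ with $\gamma_j$ bilinear; its rank is the minimum, over non-zero $u\in\mathbb{F}_p^k$, of the rank of the bilinear form $\sum_ju_j\gamma_j$ (the rank of its matrix). -}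

module Defs where

open import Data.Nat using (ℕ; zero; suc; _+_; _*_; _∸_; NonZero)
open import Data.Nat.DivMod using (_mod_)
open import Data.Fin using (Fin; toℕ)
open import Data.Fin.Properties using (all?) renaming (_≟_ to _≟F_)
open import Data.List using (List; []; _∷_; [_]; map; concatMap; filter; length; allFin)
import Data.Vec.Functional as VF
open import Relation.Nullary using (Dec; ¬_)
open import Relation.Binary.PropositionalEquality using (_≡_)
open import Data.Product using (∃; _,_)

F : ℕ → Set
F p = Fin p

module Field (p : ℕ) .{{_ : NonZero p}} where
  infixl 6 _+F_
  infixl 7 _*F_

  0F : F p
  0F = 0 mod p

  1F : F p
  1F = 1 mod p

  _+F_ : F p → F p → F p
  x +F y = (toℕ x + toℕ y) mod p

  _*F_ : F p → F p → F p
  x *F y = (toℕ x * toℕ y) mod p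

  ΣF : ∀ {n} → (Fin n → F p) → F p
  ΣF {zero}  f = 0F
  ΣF {suc n} f = f Fin.zero +F ΣF (λ i → f (Fin.suc i))
    where import Data.Fin as Fin

  Vec : ℕ → Set
  Vec n = Fin n → F p

  -- A bi-affine map F_p^a × F_p^b → F_p^k, in coordinates:
  -- β_j(x,y) = Σ_{l,m} γ_j[l][m] x_l y_m + Σ_l α_j[l] x_l + Σ_m δ_j[m] y_m + c_j
  record BiAffine (a b k : ℕ) : Set where
    field
      γ : Fin k → Fin a → Fin b → F p
      α : Fin k → Fin a → F p
      δ : Fin k → Fin b → F p
      c : Fin k → F p

  open BiAffine public

  eval : ∀ {a b k} → BiAffine a b k → Vec a → Vec b → Vec k
  eval β x y j =
    ΣF (λ l → ΣF (λ m → γ β j l m *F x l *F y m))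
      +F ΣF (λ l → α β j l *F x l)
      +F ΣF (λ m → δ β j m *F y m)
      +F c β j

  -- Rank of an a×b matrix ≥ t: there are t linearly independent columns
  -- (rank = maximal number of linearly independent columns).
  ColumnsIndependent : ∀ {a b t} → (Fin a → Fin b → F p) → (Fin t → Fin b) → Set
  ColumnsIndependent {a} {b} {t} M s =
    ∀ (coef : Fin t → F p) →
      (∀ l → ΣF (λ i → coef i *F M l (s i)) ≡ 0F) →
      ∀ i → coef i ≡ 0F

  RankAtLeast : ∀ {a b} → (Fin a → Fin b → F p) → ℕ → Set
  RankAtLeast {a} {b} M t = ∃ λ (s : Fin t → Fin b) → ColumnsIndependent M s

  combo : ∀ {a b k} → BiAffine a b k → Vec k → Fin a → Fin b → F p
  combo β u l m = ΣF (λ j → u j *F γ β j l m)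

  -- rank of β = min over nonzero u of rank(Σ_j u_j γ_j); "rank ≥ t":
  BiAffineRankAtLeast : ∀ {a b k} → BiAffine a b k → ℕ → Set
  BiAffineRankAtLeast {k = k} β t =
    ∀ (u : Vec k) → ¬ (∀ j → u j ≡ 0F) → RankAtLeast (combo β u) t

  funs : ∀ {A : Set} → List A → (n : ℕ) → List (Fin n → A)
  funs xs zero    = [ (λ ()) ]
  funs xs (suc n) = concatMap (λ v → map (λ x → x VF.∷ v) xs) (funs xs n)

  allVecs : (n : ℕ) → List (Vec n)
  allVecs n = funs (allFin p) n

  _≟V_ : ∀ {n} (u v : Vec n) → Dec (∀ i → u i ≡ v i)
  u ≟V v = all? (λ i → u i ≟F v i)

  numSolutions : ∀ {a b k r} → (Fin r → BiAffine a b k) → (Fin r → Vec k) →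
                 (Fin r → Vec a) → ℕ
  numSolutions {b = b} β z xs =
    length (filter (λ y → all? (λ i → eval (β i) (xs i) y ≟V z i)) (allVecs b))

  -- number of tuples (x_1..x_r) ∈ X^r for which the system has exactly
  -- p^{-rk}|Y| solutions, i.e. numSolutions * p^(r*k) = p^b
  numGood : ∀ {a b k r} → (Fin r → BiAffine a b k) → (Fin r → Vec k) → ℕ
  numGood {a} {b} {k} {r} β z =
    length (filter (λ xs → numSolutions β z xs * p ^ (r * k) Data.Nat.≟ p ^ b)
                   (funs (allVecs a) r))
    where open import Data.Nat using (_^_)
          import Data.Nat

-- Fix x = (x₁,…,xᵣ). For a dual vector u = (u₁,…,uᵣ) ∈ Zʳ the map y ↦ Σᵢ uᵢ·βᵢ(xᵢ,y) is affine in y;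
-- call u degenerate for x if u ≠ 0 but this map is constant. If no u is degenerate, counting the pairs
-- (y, u) with Σᵢ uᵢ·βᵢ(xᵢ,y) = Σᵢ uᵢ·zᵢ in two ways (a nonconstant affine form takes each value equally
-- often) shows that the system has exactly p^{-rk}|Y| solutions. If u ≠ 0, say uᵢ ≠ 0, then t
-- independent columns of Σⱼ uᵢⱼγᵢⱼ select t coordinates of the slope of that map which depend affinely
-- on x with independent linear parts; the same double counting shows they all vanish for only a p^{-t}
-- fraction of the x. A union bound over the p^{rk} dual vectors finishes the proof.

module Submission where

open import Defs
open import Data.Nat using (ℕ; NonZero; _^_; _*_)
open import Data.Nat.Primality using (Prime)
open import Data.Fin using (Fin)

open import Algebra.Bundles using (CommutativeRing)
import Algebra.Properties.Semiring.Sum as SemiringSum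
open import Data.Empty using (⊥-elim)
open import Data.Fin using (toℕ; zero; suc)
open import Data.Fin.Properties using (all?; _≟_)
import Data.Fin.Properties as Finₚ
open import Data.List using (List; []; _∷_; _++_; map; concatMap; filter; length; allFin)
open import Data.List.Properties using (map-tabulate; length-tabulate)
open import Data.List.Relation.Unary.All as All using (All; []; _∷_)
open import Data.Nat using (zero; suc; _+_; _∸_; _≤_; _<_; z≤n; s≤s; ≢-nonZero; >-nonZero; nonTrivial⇒n>1)
open import Data.Nat.Coprimality using (prime⇒coprime; coprime-Bézout)
open import Data.Nat.DivMod using (_mod_; _%_; m%n<n; m<n⇒m%n≡m; %-distribˡ-+; %-distribˡ-*; m*n%n≡0; n%n≡0)
open import Data.Nat.GCD using (module Bézout)
open import Data.Nat.Primality using (prime⇒nonTrivial)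
import Data.Nat.Properties as ℕ
open import Data.Nat.Solver using () renaming (module +-*-Solver to ℕ-Solver)
open import Data.Product using (∃; _×_; _,_; proj₁; proj₂)
import Data.Vec.Functional as VF
open import Function using (_∘_; id)
open import Level using (0ℓ)
open import Relation.Binary.PropositionalEquality
open import Relation.Binary.PropositionalEquality.Algebra using (isMagma)
open import Relation.Nullary using (Dec; yes; no; ¬_)
open import Relation.Nullary.Decidable using (_×-dec_; ¬?)
open import Relation.Unary using (Decidable)
open import Algebra.Properties.CommutativeSemigroup ℕ.+-commutativeSemigroup
  using () renaming (interchange to +-interchange)

variable
  A B : Set

∑ : List A → (A → ℕ) → ℕ
∑ []       f = 0
∑ (x ∷ xs) f = f x + ∑ xs f

infix 5 ∑
syntax ∑ xs (λ x → e) = ∑[ x ∈ xs ] e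

𝟙 : {P : Set} → Dec P → ℕ
𝟙 (yes _) = 1
𝟙 (no  _) = 0

𝟙-cong : {P Q : Set} (P? : Dec P) (Q? : Dec Q) → (P → Q) → (Q → P) → 𝟙 P? ≡ 𝟙 Q?
𝟙-cong (yes _) (yes _) _   _   = refl
𝟙-cong (yes p) (no ¬q) p→q _   = ⊥-elim (¬q (p→q p))
𝟙-cong (no ¬p) (yes q) _   q→p = ⊥-elim (¬p (q→p q))
𝟙-cong (no _)  (no _)  _   _   = refl

𝟙-true : {P : Set} (P? : Dec P) → P → 𝟙 P? ≡ 1
𝟙-true (yes _) _ = refl
𝟙-true (no ¬p) p = ⊥-elim (¬p p)

𝟙-false : {P : Set} (P? : Dec P) → ¬ P → 𝟙 P? ≡ 0
𝟙-false (yes p) ¬p = ⊥-elim (¬p p)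
𝟙-false (no _)  _  = refl

𝟙≡0⇒¬ : {P : Set} (P? : Dec P) → 𝟙 P? ≡ 0 → ¬ P
𝟙≡0⇒¬ (no ¬p) _ = ¬p

𝟙-mono : {P Q : Set} (P? : Dec P) (Q? : Dec Q) → (P → Q) → 𝟙 P? ≤ 𝟙 Q?
𝟙-mono (yes p) (yes _) _   = ℕ.≤-refl
𝟙-mono (yes p) (no ¬q) p→q = ⊥-elim (¬q (p→q p))
𝟙-mono (no _)  _       _   = z≤n

𝟙-× : {P Q : Set} (P? : Dec P) (Q? : Dec Q) → 𝟙 (P? ×-dec Q?) ≡ 𝟙 P? * 𝟙 Q?
𝟙-× (yes _) (yes _) = refl
𝟙-× (yes _) (no _)  = refl
𝟙-× (no _)  _       = refl

length-filter : {P : A → Set} (P? : Decidable P) (xs : List A) →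
                length (filter P? xs) ≡ ∑[ x ∈ xs ] 𝟙 (P? x)
length-filter P? []       = refl
length-filter P? (x ∷ xs) with P? x
... | yes _ = cong suc (length-filter P? xs)
... | no  _ = length-filter P? xs

∑-cong : (xs : List A) {f g : A → ℕ} → (∀ x → f x ≡ g x) → ∑ xs f ≡ ∑ xs g
∑-cong []       f≗g = refl
∑-cong (x ∷ xs) f≗g = cong₂ _+_ (f≗g x) (∑-cong xs f≗g)

∑-congᴬ : (xs : List A) {f g : A → ℕ} → All (λ x → f x ≡ g x) xs → ∑ xs f ≡ ∑ xs g
∑-congᴬ []       []           = refl
∑-congᴬ (x ∷ xs) (fx≡gx ∷ eq) = cong₂ _+_ fx≡gx (∑-congᴬ xs eq)

∑-mono : (xs : List A) {f g : A → ℕ} → (∀ x → f x ≤ g x) → ∑ xs f ≤ ∑ xs g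
∑-mono []       f≤g = z≤n
∑-mono (x ∷ xs) f≤g = ℕ.+-mono-≤ (f≤g x) (∑-mono xs f≤g)

∑≡0⇒All : (xs : List A) (f : A → ℕ) → ∑ xs f ≡ 0 → All (λ x → f x ≡ 0) xs
∑≡0⇒All []       f _  = []
∑≡0⇒All (x ∷ xs) f eq = ℕ.m+n≡0⇒m≡0 (f x) eq ∷ ∑≡0⇒All xs f (ℕ.m+n≡0⇒n≡0 (f x) eq)

∑-const : (xs : List A) (k : ℕ) → ∑[ _ ∈ xs ] k ≡ length xs * k
∑-const []       k = refl
∑-const (x ∷ xs) k = cong (k +_) (∑-const xs k)

∑-zero : (xs : List A) {f : A → ℕ} → (∀ x → f x ≡ 0) → ∑ xs f ≡ 0
∑-zero []       f≗0 = refl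
∑-zero (x ∷ xs) f≗0 = cong₂ _+_ (f≗0 x) (∑-zero xs f≗0)

∑-1 : (xs : List A) → ∑[ _ ∈ xs ] 1 ≡ length xs
∑-1 xs = trans (∑-const xs 1) (ℕ.*-identityʳ (length xs))

count-universal : {P : A → Set} (P? : Decidable P) (xs : List A) → (∀ x → P x) → ∑[ x ∈ xs ] 𝟙 (P? x) ≡ length xs
count-universal P? xs all-P = trans (∑-cong xs (λ x → 𝟙-true (P? x) (all-P x))) (∑-1 xs)

∑-distrib-+ : (xs : List A) (f g : A → ℕ) → ∑[ x ∈ xs ] (f x + g x) ≡ ∑ xs f + ∑ xs g
∑-distrib-+ []       f g = refl
∑-distrib-+ (x ∷ xs) f g =
  trans (cong (f x + g x +_) (∑-distrib-+ xs f g)) (+-interchange (f x) (g x) (∑ xs f) (∑ xs g))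

∑-*ʳ : (xs : List A) (f : A → ℕ) (k : ℕ) → ∑[ x ∈ xs ] (f x * k) ≡ ∑ xs f * k
∑-*ʳ []       f k = refl
∑-*ʳ (x ∷ xs) f k = trans (cong (f x * k +_) (∑-*ʳ xs f k)) (sym (ℕ.*-distribʳ-+ k (f x) (∑ xs f)))

∑-*ˡ : (xs : List A) (f : A → ℕ) (k : ℕ) → ∑[ x ∈ xs ] (k * f x) ≡ k * ∑ xs f
∑-*ˡ xs f k = trans (∑-cong xs (λ x → ℕ.*-comm k (f x))) (trans (∑-*ʳ xs f k) (ℕ.*-comm (∑ xs f) k))

∑-++ : (xs ys : List A) (f : A → ℕ) → ∑ (xs ++ ys) f ≡ ∑ xs f + ∑ ys f
∑-++ []       ys f = refl
∑-++ (x ∷ xs) ys f = trans (cong (f x +_) (∑-++ xs ys f)) (sym (ℕ.+-assoc (f x) (∑ xs f) (∑ ys f)))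

∑-comm : (xs : List A) (ys : List B) (f : A → B → ℕ) →
         ∑[ x ∈ xs ] ∑ ys (f x) ≡ ∑[ y ∈ ys ] ∑[ x ∈ xs ] f x y
∑-comm []       ys f = sym (∑-zero ys (λ _ → refl))
∑-comm (x ∷ xs) ys f = trans (cong (∑ ys (f x) +_) (∑-comm xs ys f))
                             (sym (∑-distrib-+ ys (f x) (λ y → ∑[ x′ ∈ xs ] f x′ y)))

∑-concatMap : (g : A → List B) (xs : List A) (f : B → ℕ) →
              ∑ (concatMap g xs) f ≡ ∑[ x ∈ xs ] ∑ (g x) f
∑-concatMap g []       f = refl
∑-concatMap g (x ∷ xs) f = trans (∑-++ (g x) (concatMap g xs) f) (cong (∑ (g x) f +_) (∑-concatMap g xs f))

∑-map : (g : A → B) (xs : List A) (f : B → ℕ) → ∑ (map g xs) f ≡ ∑ xs (f ∘ g)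
∑-map g []       f = refl
∑-map g (x ∷ xs) f = cong (f (g x) +_) (∑-map g xs f)

∑-allFin-suc : ∀ {n} (f : Fin (suc n) → ℕ) → ∑ (allFin (suc n)) f ≡ f zero + (∑[ i ∈ allFin n ] f (suc i))
∑-allFin-suc {n} f = cong (f zero +_) (trans (cong (λ is → ∑ is f) (sym (map-tabulate id suc))) (∑-map suc (allFin n) f))

count-allFin : ∀ {n} (e : Fin n) → ∑[ i ∈ allFin n ] 𝟙 (i ≟ e) ≡ 1
count-allFin {suc n} zero = trans (∑-allFin-suc {n} (λ i → 𝟙 (i ≟ zero)))
  (cong suc (∑-zero (allFin n) (λ i → 𝟙-false (suc i ≟ zero) (λ ()))))
count-allFin {suc n} (suc e) = trans (∑-allFin-suc {n} (λ i → 𝟙 (i ≟ suc e)))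
  (trans (∑-cong (allFin n) (λ i → 𝟙-cong (suc i ≟ suc e) (i ≟ e) Finₚ.suc-injective (cong suc)))
         (count-allFin e))

-- Double counting

∑-pointwise-identity : (xs : List A) (f g : A → ℕ) (q K : ℕ) →
                       All (λ x → f x * q + g x * K ≡ g x * (K * q) + K) xs →
                       ∑ xs f * q + ∑ xs g * K ≡ ∑ xs g * (K * q) + length xs * K
∑-pointwise-identity xs f g q K eqs = begin
  ∑ xs f * q + ∑ xs g * K                           ≡⟨ cong₂ _+_ (∑-*ʳ xs f q) (∑-*ʳ xs g K) ⟨
  (∑[ x ∈ xs ] f x * q) + (∑[ x ∈ xs ] g x * K)     ≡⟨ ∑-distrib-+ xs _ _ ⟨
  ∑[ x ∈ xs ] (f x * q + g x * K)                   ≡⟨ ∑-congᴬ xs eqs ⟩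
  ∑[ x ∈ xs ] (g x * (K * q) + K)                   ≡⟨ ∑-distrib-+ xs _ _ ⟩
  (∑[ x ∈ xs ] g x * (K * q)) + (∑[ _ ∈ xs ] K)     ≡⟨ cong₂ _+_ (∑-*ʳ xs g (K * q)) (∑-const xs K) ⟩
  ∑ xs g * (K * q) + length xs * K                  ∎
  where open ≡-Reasoning

*-+-cancel : ∀ {a b q} → 1 < q → a * q + b ≡ b * q + a → a ≡ b
*-+-cancel {a} {b} {suc q} (s≤s 1≤q) eq = ℕ.*-cancelʳ-≡ a b q {{>-nonZero 1≤q}}
  (ℕ.+-cancelʳ-≡ (a + b) (a * q) (b * q) (begin
    a * q + (a + b)     ≡⟨ solve 3 (λ a b q → a :* q :+ (a :+ b) := a :* (con 1 :+ q) :+ b) refl a b q ⟩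
    a * suc q + b       ≡⟨ eq ⟩
    b * suc q + a       ≡⟨ solve 3 (λ a b q → b :* (con 1 :+ q) :+ a := b :* q :+ (a :+ b)) refl a b q ⟩
    b * q + (a + b)     ∎))
  where
  open ≡-Reasoning
  open ℕ-Solver using (solve; _:+_; _:*_; _:=_; con)

-- Counting the incidences by rows and by columns gives two linear relations whose difference is
-- (q − 1)(#G·|us| − |ds|) = 0.
double-counting : {D U : Set} {P : D → U → Set} {G : D → Set} {Z : U → Set}
  (q : ℕ) → 1 < q → (ds : List D) (us : List U) →
  (P? : ∀ y u → Dec (P y u)) (G? : Decidable G) (Z? : Decidable Z) →
  (∀ y → G y → ∀ u → P y u) →
  (∀ y → ¬ G y → (∑[ u ∈ us ] 𝟙 (P? y u)) * q ≡ length us) →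
  (∀ u → Z u → ∀ y → P y u) →
  All (λ u → ¬ Z u → (∑[ y ∈ ds ] 𝟙 (P? y u)) * q ≡ length ds) us →
  ∑[ u ∈ us ] 𝟙 (Z? u) ≡ 1 →
  (∑[ y ∈ ds ] 𝟙 (G? y)) * length us ≡ length ds
double-counting {Z = Z} q 1<q ds us P? G? Z? good⇒full bad⇒sparse zero⇒full nonzero⇒sparse one-zero =
  *-+-cancel 1<q (ℕ.+-cancelʳ-≡ (X * q + N * M) (GM * q + N) (N * q + GM) (begin
    GM * q + N + (X * q + N * M)       ≡⟨ solve 5 (λ a n x m q → a :* q :+ n :+ (x :* q :+ n :* m)
                                                              := (a :* q :+ n :* m) :+ (x :* q :+ n)) refl GM N X M q ⟩
    (GM * q + N * M) + (X * q + N)     ≡⟨ cong₂ _+_ (sym by-rows) by-columns ⟩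
    (X * q + GM) + (N * q + M * N)     ≡⟨ solve 5 (λ a n x m q → (x :* q :+ a) :+ (n :* q :+ m :* n)
                                                              := n :* q :+ a :+ (x :* q :+ n :* m)) refl GM N X M q ⟩
    N * q + GM + (X * q + N * M)       ∎))
  where
  open ≡-Reasoning
  open ℕ-Solver using (solve; _:+_; _:*_; _:=_)
  N = length ds
  M = length us
  g = λ y → 𝟙 (G? y)
  X = ∑[ y ∈ ds ] ∑[ u ∈ us ] 𝟙 (P? y u)
  GM = ∑ ds g * M

  row : ∀ y → (∑[ u ∈ us ] 𝟙 (P? y u)) * q + g y * M ≡ g y * (M * q) + M
  row y with G? y
  ... | yes Gy = cong₂ _+_ (trans (cong (_* q) (count-universal (P? y) us (good⇒full y Gy)))
                                  (sym (ℕ.*-identityˡ (M * q))))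
                           (ℕ.*-identityˡ M)
  ... | no ¬Gy = trans (ℕ.+-identityʳ _) (bad⇒sparse y ¬Gy)

  column : ∀ u → (¬ Z u → (∑[ y ∈ ds ] 𝟙 (P? y u)) * q ≡ N) →
           (∑[ y ∈ ds ] 𝟙 (P? y u)) * q + 𝟙 (Z? u) * N ≡ 𝟙 (Z? u) * (N * q) + N
  column u sparse with Z? u
  ... | yes Zu = cong₂ _+_ (trans (cong (_* q) (count-universal (λ y → P? y u) ds (zero⇒full u Zu)))
                                  (sym (ℕ.*-identityˡ (N * q))))
                           (ℕ.*-identityˡ N)
  ... | no ¬Zu = trans (ℕ.+-identityʳ _) (sparse ¬Zu)

  by-rows : X * q + GM ≡ GM * q + N * M
  by-rows = trans (∑-pointwise-identity ds _ g q M (All.universal row ds)) (cong (_+ N * M) (sym (ℕ.*-assoc (∑ ds g) M q)))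

  X′ = ∑[ u ∈ us ] ∑[ y ∈ ds ] 𝟙 (P? y u)

  by-columns : X * q + N ≡ N * q + M * N
  by-columns = begin
    X * q + N                          ≡⟨ cong₂ (λ x n → x * q + n) (∑-comm ds us _) (sym (ℕ.*-identityˡ N)) ⟩
    X′ * q + 1 * N                     ≡⟨ cong (λ z → X′ * q + z * N) one-zero ⟨
    X′ * q + ∑ us (𝟙 ∘ Z?) * N         ≡⟨ ∑-pointwise-identity us _ _ q N (All.map (λ {u} → column u) nonzero⇒sparse) ⟩
    ∑ us (𝟙 ∘ Z?) * (N * q) + M * N    ≡⟨ cong (λ z → z * (N * q) + M * N) one-zero ⟩
    1 * (N * q) + M * N                ≡⟨ cong (_+ M * N) (ℕ.*-identityˡ (N * q)) ⟩
    N * q + M * N                      ∎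

module Residues (p : ℕ) .{{_ : NonZero p}} where
  open Field p

  reduce : ℕ → F p
  reduce m = m mod p

  toℕ-reduce : ∀ m → toℕ (reduce m) ≡ m % p
  toℕ-reduce m = Finₚ.toℕ-fromℕ< (m%n<n m p)

  reduce-cong : ∀ {m n} → m % p ≡ n % p → reduce m ≡ reduce n
  reduce-cong {m} {n} eq = Finₚ.toℕ-injective (trans (toℕ-reduce m) (trans eq (sym (toℕ-reduce n))))

  reduce-toℕ : ∀ x → reduce (toℕ x) ≡ x
  reduce-toℕ x = Finₚ.toℕ-injective (trans (toℕ-reduce (toℕ x)) (m<n⇒m%n≡m (Finₚ.toℕ<n x)))

  reduce-+ : ∀ m n → reduce (m + n) ≡ reduce m +F reduce n
  reduce-+ m n = trans (reduce-cong (%-distribˡ-+ m n p))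
    (sym (cong₂ (λ a b → reduce (a + b)) (toℕ-reduce m) (toℕ-reduce n)))

  reduce-* : ∀ m n → reduce (m * n) ≡ reduce m *F reduce n
  reduce-* m n = trans (reduce-cong (%-distribˡ-* m n p))
    (sym (cong₂ (λ a b → reduce (a * b)) (toℕ-reduce m) (toℕ-reduce n)))

  reduce-*-toℕ : ∀ m x → reduce m *F x ≡ reduce (m * toℕ x)
  reduce-*-toℕ m x = trans (cong (reduce m *F_) (sym (reduce-toℕ x))) (sym (reduce-* m (toℕ x)))

  reduce-*p : ∀ m → reduce (m * p) ≡ 0F
  reduce-*p m = reduce-cong (trans (m*n%n≡0 m p) (sym (m*n%n≡0 0 p)))

  toℕ-nonZero : ∀ {x} → x ≢ 0F → NonZero (toℕ x)
  toℕ-nonZero x≢0 = ≢-nonZero (λ x≡0 → x≢0 (trans (sym (reduce-toℕ _)) (cong reduce x≡0)))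

  -F_ : F p → F p
  -F x = reduce (p ∸ toℕ x)

  infix 8 -F_

  reduce-p : reduce p ≡ 0F
  reduce-p = reduce-cong (trans (n%n≡0 p) (sym (m*n%n≡0 0 p)))

  +F-comm : ∀ x y → x +F y ≡ y +F x
  +F-comm x y = cong reduce (ℕ.+-comm (toℕ x) (toℕ y))

  *F-comm : ∀ x y → x *F y ≡ y *F x
  *F-comm x y = cong reduce (ℕ.*-comm (toℕ x) (toℕ y))

  +F-assoc : ∀ x y z → (x +F y) +F z ≡ x +F (y +F z)
  +F-assoc x y z = begin
    (x +F y) +F z                           ≡⟨ cong ((x +F y) +F_) (reduce-toℕ z) ⟨
    reduce (toℕ x + toℕ y) +F reduce (toℕ z)  ≡⟨ reduce-+ (toℕ x + toℕ y) (toℕ z) ⟨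
    reduce (toℕ x + toℕ y + toℕ z)            ≡⟨ cong reduce (ℕ.+-assoc (toℕ x) (toℕ y) (toℕ z)) ⟩
    reduce (toℕ x + (toℕ y + toℕ z))          ≡⟨ reduce-+ (toℕ x) (toℕ y + toℕ z) ⟩
    reduce (toℕ x) +F (y +F z)                ≡⟨ cong (_+F (y +F z)) (reduce-toℕ x) ⟩
    x +F (y +F z)                           ∎
    where open ≡-Reasoning

  *F-assoc : ∀ x y z → (x *F y) *F z ≡ x *F (y *F z)
  *F-assoc x y z = begin
    (x *F y) *F z                           ≡⟨ cong ((x *F y) *F_) (reduce-toℕ z) ⟨
    reduce (toℕ x * toℕ y) *F reduce (toℕ z)  ≡⟨ reduce-* (toℕ x * toℕ y) (toℕ z) ⟨
    reduce (toℕ x * toℕ y * toℕ z)            ≡⟨ cong reduce (ℕ.*-assoc (toℕ x) (toℕ y) (toℕ z)) ⟩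
    reduce (toℕ x * (toℕ y * toℕ z))          ≡⟨ reduce-* (toℕ x) (toℕ y * toℕ z) ⟩
    reduce (toℕ x) *F (y *F z)                ≡⟨ cong (_*F (y *F z)) (reduce-toℕ x) ⟩
    x *F (y *F z)                           ∎
    where open ≡-Reasoning

  *F-distribˡ-+F : ∀ x y z → x *F (y +F z) ≡ x *F y +F x *F z
  *F-distribˡ-+F x y z = begin
    x *F (y +F z)                           ≡⟨ cong (_*F (y +F z)) (reduce-toℕ x) ⟨
    reduce (toℕ x) *F reduce (toℕ y + toℕ z)  ≡⟨ reduce-* (toℕ x) (toℕ y + toℕ z) ⟨
    reduce (toℕ x * (toℕ y + toℕ z))          ≡⟨ cong reduce (ℕ.*-distribˡ-+ (toℕ x) (toℕ y) (toℕ z)) ⟩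
    reduce (toℕ x * toℕ y + toℕ x * toℕ z)    ≡⟨ reduce-+ (toℕ x * toℕ y) (toℕ x * toℕ z) ⟩
    x *F y +F x *F z                        ∎
    where open ≡-Reasoning

  +F-identityˡ : ∀ x → 0F +F x ≡ x
  +F-identityˡ x = begin
    0F +F x                    ≡⟨ cong (0F +F_) (reduce-toℕ x) ⟨
    reduce 0 +F reduce (toℕ x)  ≡⟨ reduce-+ 0 (toℕ x) ⟨
    reduce (toℕ x)              ≡⟨ reduce-toℕ x ⟩
    x                          ∎
    where open ≡-Reasoning

  *F-identityˡ : ∀ x → 1F *F x ≡ x
  *F-identityˡ x = begin
    1F *F x                    ≡⟨ cong (1F *F_) (reduce-toℕ x) ⟨
    reduce 1 *F reduce (toℕ x)  ≡⟨ reduce-* 1 (toℕ x) ⟨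
    reduce (1 * toℕ x)          ≡⟨ cong reduce (ℕ.*-identityˡ (toℕ x)) ⟩
    reduce (toℕ x)              ≡⟨ reduce-toℕ x ⟩
    x                          ∎
    where open ≡-Reasoning

  +F-inverseʳ : ∀ x → x +F -F x ≡ 0F
  +F-inverseʳ x = begin
    x +F -F x                         ≡⟨ cong (_+F -F x) (reduce-toℕ x) ⟨
    reduce (toℕ x) +F reduce (p ∸ toℕ x) ≡⟨ reduce-+ (toℕ x) (p ∸ toℕ x) ⟨
    reduce (toℕ x + (p ∸ toℕ x))         ≡⟨ cong reduce (ℕ.m+[n∸m]≡n (ℕ.<⇒≤ (Finₚ.toℕ<n x))) ⟩
    reduce p                          ≡⟨ reduce-p ⟩
    0F                                ∎
    where open ≡-Reasoning

  𝔽 : CommutativeRing 0ℓ 0ℓ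
  𝔽 = record
    { isCommutativeRing = record
      { isRing = record
        { +-isAbelianGroup = record
          { isGroup = record
            { isMonoid = record
              { isSemigroup = record { isMagma = isMagma _+F_ ; assoc = +F-assoc }
              ; identity    = +F-identityˡ , λ x → trans (+F-comm x 0F) (+F-identityˡ x)
              }
            ; inverse = (λ x → trans (+F-comm (-F x) x) (+F-inverseʳ x)) , +F-inverseʳ
            ; ⁻¹-cong = cong -F_
            }
          ; comm = +F-comm
          }
        ; *-cong     = cong₂ _*F_
        ; *-assoc    = *F-assoc
        ; *-identity = *F-identityˡ , λ x → trans (*F-comm x 1F) (*F-identityˡ x)
        ; distrib    = *F-distribˡ-+F
                     , λ x y z → trans (*F-comm (y +F z) x)
                                       (trans (*F-distribˡ-+F x y z) (cong₂ _+F_ (*F-comm x y) (*F-comm x z)))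
        }
      ; *-comm = *F-comm
      }
    }

  open CommutativeRing 𝔽 public
    using (+-identityˡ; +-identityʳ; zeroˡ; zeroʳ; *-identityˡ; distribʳ)
  open import Algebra.Properties.Ring (CommutativeRing.ring 𝔽) public
    using ( -‿involutive; +-inverseʳ-unique; -‿distribˡ-*
          ; x∙y⁻¹≈ε⇒x≈y; x≈y⇒x∙y⁻¹≈ε; //-rightDividesˡ; //-rightDividesʳ )
  open import Algebra.Properties.CommutativeSemigroup (CommutativeRing.+-commutativeSemigroup 𝔽) public
    using () renaming (interchange to +F-interchange)
  private
    module Sum = SemiringSum (CommutativeRing.semiring 𝔽)
    open Sum using (sum)

  +F-move : ∀ {a b c} → a +F b ≡ c → a ≡ c +F -F b
  +F-move {a} {b} a+b≡c = trans (sym (//-rightDividesʳ b a)) (cong (_+F -F b) a+b≡c)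

  +F-shift : ∀ a b c → 𝟙 (a +F b ≟ c) ≡ 𝟙 (a ≟ c +F -F b)
  +F-shift a b c = 𝟙-cong (a +F b ≟ c) (a ≟ c +F -F b) +F-move
    (λ a≡c-b → trans (cong (_+F b) a≡c-b) (//-rightDividesˡ b c))

  ΣF-cong : ∀ {n} {f g : Fin n → F p} → (∀ i → f i ≡ g i) → ΣF f ≡ ΣF g
  ΣF-cong {zero}  f≗g = refl
  ΣF-cong {suc n} f≗g = cong₂ _+F_ (f≗g zero) (ΣF-cong (f≗g ∘ suc))

  ΣF-zero : ∀ {n} {f : Fin n → F p} → (∀ i → f i ≡ 0F) → ΣF f ≡ 0F
  ΣF-zero {zero}  f≗0 = refl
  ΣF-zero {suc n} f≗0 = trans (cong₂ _+F_ (f≗0 zero) (ΣF-zero (f≗0 ∘ suc))) (+-identityˡ 0F)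

  ΣF≡sum : ∀ {n} (f : Fin n → F p) → ΣF f ≡ sum f
  ΣF≡sum {zero}  f = refl
  ΣF≡sum {suc n} f = cong (f zero +F_) (ΣF≡sum (f ∘ suc))

  ΣF-distrib-+F : ∀ {n} (f g : Fin n → F p) → ΣF (λ i → f i +F g i) ≡ ΣF f +F ΣF g
  ΣF-distrib-+F f g = begin
    ΣF (λ i → f i +F g i)  ≡⟨ ΣF≡sum (λ i → f i +F g i) ⟩
    sum (λ i → f i +F g i) ≡⟨ Sum.∑-distrib-+ f g ⟩
    sum f +F sum g         ≡⟨ cong₂ _+F_ (ΣF≡sum f) (ΣF≡sum g) ⟨
    ΣF f +F ΣF g           ∎
    where open ≡-Reasoning

  ΣF-comm : ∀ {m n} (f : Fin m → Fin n → F p) →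
            ΣF (λ i → ΣF (λ j → f i j)) ≡ ΣF (λ j → ΣF (λ i → f i j))
  ΣF-comm f = begin
    ΣF (λ i → ΣF (f i))                ≡⟨ ΣF²≡sum² f ⟩
    sum (λ i → sum (f i))              ≡⟨ Sum.∑-comm f ⟩
    sum (λ j → sum (λ i → f i j))      ≡⟨ ΣF²≡sum² (λ j i → f i j) ⟨
    ΣF (λ j → ΣF (λ i → f i j))        ∎
    where
    open ≡-Reasoning
    ΣF²≡sum² : ∀ {m n} (g : Fin m → Fin n → F p) → ΣF (λ i → ΣF (g i)) ≡ sum (λ i → sum (g i))
    ΣF²≡sum² g = trans (ΣF-cong (λ i → ΣF≡sum (g i))) (ΣF≡sum (λ i → sum (g i)))

  *F-distribˡ-ΣF : ∀ {n} k (f : Fin n → F p) → k *F ΣF f ≡ ΣF (λ i → k *F f i)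
  *F-distribˡ-ΣF k f =
    trans (cong (k *F_) (ΣF≡sum f)) (trans (Sum.*-distribˡ-sum k f) (sym (ΣF≡sum (λ i → k *F f i))))

  *F-distribʳ-ΣF : ∀ {n} k (f : Fin n → F p) → ΣF f *F k ≡ ΣF (λ i → f i *F k)
  *F-distribʳ-ΣF k f =
    trans (cong (_*F k) (ΣF≡sum f)) (trans (Sum.*-distribʳ-sum k f) (sym (ΣF≡sum (λ i → f i *F k))))

  IsZero : ∀ {n} → Vec n → Set
  IsZero v = ∀ j → v j ≡ 0F

  isZero? : ∀ {n} (v : Vec n) → Dec (IsZero v)
  isZero? v = all? (λ j → v j ≟ 0F)

  infix 7 _·_
  _·_ : ∀ {n} → Vec n → Vec n → F p
  u · v = ΣF (λ j → u j *F v j)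

  ·-comm : ∀ {n} (u v : Vec n) → u · v ≡ v · u
  ·-comm u v = ΣF-cong (λ j → *F-comm (u j) (v j))

  ·-congˡ : ∀ {n} {u u′ : Vec n} (v : Vec n) → (∀ j → u j ≡ u′ j) → u · v ≡ u′ · v
  ·-congˡ v u≗u′ = ΣF-cong (λ j → cong (_*F v j) (u≗u′ j))

  ·-congʳ : ∀ {n} (u : Vec n) {v v′ : Vec n} → (∀ j → v j ≡ v′ j) → u · v ≡ u · v′
  ·-congʳ u v≗v′ = ΣF-cong (λ j → cong (u j *F_) (v≗v′ j))

  ·-zeroˡ : ∀ {n} {u : Vec n} (v : Vec n) → IsZero u → u · v ≡ 0F
  ·-zeroˡ v u≗0 = ΣF-zero (λ j → trans (cong (_*F v j) (u≗0 j)) (zeroˡ (v j)))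

  ·-zeroʳ : ∀ {n} (u : Vec n) {v : Vec n} → IsZero v → u · v ≡ 0F
  ·-zeroʳ u v≗0 = ΣF-zero (λ j → trans (cong (u j *F_) (v≗0 j)) (zeroʳ (u j)))

  ·-distribʳ-+F : ∀ {n} (u v w : Vec n) → u · (λ j → v j +F w j) ≡ u · v +F u · w
  ·-distribʳ-+F u v w =
    trans (ΣF-cong (λ j → *F-distribˡ-+F (u j) (v j) (w j))) (ΣF-distrib-+F (λ j → u j *F v j) (λ j → u j *F w j))

  ·-distribˡ-+F : ∀ {n} (u v w : Vec n) → (λ j → u j +F v j) · w ≡ u · w +F v · w
  ·-distribˡ-+F u v w =
    trans (ΣF-cong (λ j → distribʳ (w j) (u j) (v j))) (ΣF-distrib-+F (λ j → u j *F w j) (λ j → v j *F w j))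

  ·-distribʳ-ΣF : ∀ {m n} (u : Vec n) (f : Fin m → Vec n) → u · (λ j → ΣF (λ i → f i j)) ≡ ΣF (λ i → u · f i)
  ·-distribʳ-ΣF u f = trans (ΣF-cong (λ j → *F-distribˡ-ΣF (u j) (λ i → f i j))) (ΣF-comm (λ j i → u j *F f i j))

  ·-distribˡ-ΣF : ∀ {m n} (f : Fin m → Vec n) (v : Vec n) → (λ j → ΣF (λ i → f i j)) · v ≡ ΣF (λ i → f i · v)
  ·-distribˡ-ΣF f v = trans (·-comm _ v) (trans (·-distribʳ-ΣF v f) (ΣF-cong (λ i → ·-comm v (f i))))

  ·-transpose : ∀ {m n} (u : Vec n) (M : Fin m → Fin n → F p) (v : Vec m) →
                u · (λ j → (λ i → M i j) · v) ≡ (λ i → u · M i) · v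
  ·-transpose u M v = begin
    ΣF (λ j → u j *F ΣF (λ i → M i j *F v i))    ≡⟨ ΣF-cong (λ j → *F-distribˡ-ΣF (u j) (λ i → M i j *F v i)) ⟩
    ΣF (λ j → ΣF (λ i → u j *F (M i j *F v i)))  ≡⟨ ΣF-comm (λ j i → u j *F (M i j *F v i)) ⟩
    ΣF (λ i → ΣF (λ j → u j *F (M i j *F v i)))  ≡⟨ ΣF-cong (λ i → ΣF-cong (λ j → *F-assoc (u j) (M i j) (v i))) ⟨
    ΣF (λ i → ΣF (λ j → (u j *F M i j) *F v i))  ≡⟨ ΣF-cong (λ i → *F-distribʳ-ΣF (v i) (λ j → u j *F M i j)) ⟨
    ΣF (λ i → (u · M i) *F v i)                  ∎
    where open ≡-Reasoning

  Matrix : ℕ → ℕ → Set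
  Matrix r n = Fin r → Vec n

  allMatrices : (r n : ℕ) → List (Matrix r n)
  allMatrices r n = funs (allVecs n) r

  IsZeroᴹ : ∀ {r n} → Matrix r n → Set
  IsZeroᴹ u = ∀ i → IsZero (u i)

  isZeroᴹ? : ∀ {r n} (u : Matrix r n) → Dec (IsZeroᴹ u)
  isZeroᴹ? u = all? (λ i → isZero? (u i))

  ⟪_,_⟫ : ∀ {r n} → Matrix r n → Matrix r n → F p
  ⟪ u , w ⟫ = ΣF (λ i → u i · w i)

  ⟪⟫-comm : ∀ {r n} (u w : Matrix r n) → ⟪ u , w ⟫ ≡ ⟪ w , u ⟫
  ⟪⟫-comm u w = ΣF-cong (λ i → ·-comm (u i) (w i))

  ⟪⟫-congʳ : ∀ {r n} (u : Matrix r n) {w w′ : Matrix r n} → (∀ i j → w i j ≡ w′ i j) → ⟪ u , w ⟫ ≡ ⟪ u , w′ ⟫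
  ⟪⟫-congʳ u w≗w′ = ΣF-cong (λ i → ·-congʳ (u i) (w≗w′ i))

  ⟪⟫-zeroˡ : ∀ {r n} {u : Matrix r n} (w : Matrix r n) → IsZeroᴹ u → ⟪ u , w ⟫ ≡ 0F
  ⟪⟫-zeroˡ w u≗0 = ΣF-zero (λ i → ·-zeroˡ (w i) (u≗0 i))

  ⟪⟫-distribʳ-+F : ∀ {r n} (u w w′ : Matrix r n) → ⟪ u , (λ i j → w i j +F w′ i j) ⟫ ≡ ⟪ u , w ⟫ +F ⟪ u , w′ ⟫
  ⟪⟫-distribʳ-+F u w w′ =
    trans (ΣF-cong (λ i → ·-distribʳ-+F (u i) (w i) (w′ i))) (ΣF-distrib-+F (λ i → u i · w i) (λ i → u i · w′ i))

  ⟪⟫-sub : ∀ {r n} (u w w′ : Matrix r n) → ⟪ u , (λ i j → w i j +F -F w′ i j) ⟫ ≡ ⟪ u , w ⟫ +F -F ⟪ u , w′ ⟫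
  ⟪⟫-sub u w w′ = +F-move (begin
    ⟪ u , (λ i j → w i j +F -F w′ i j) ⟫ +F ⟪ u , w′ ⟫    ≡⟨ ⟪⟫-distribʳ-+F u _ w′ ⟨
    ⟪ u , (λ i j → w i j +F -F w′ i j +F w′ i j) ⟫       ≡⟨ ⟪⟫-congʳ u (λ i j → //-rightDividesˡ (w′ i j) (w i j)) ⟩
    ⟪ u , w ⟫                                            ∎)
    where open ≡-Reasoning

  ∑-funs-suc : (xs : List A) (n : ℕ) (f : (Fin (suc n) → A) → ℕ) →
               ∑ (funs xs (suc n)) f ≡ ∑[ v ∈ funs xs n ] ∑[ x ∈ xs ] f (x VF.∷ v)
  ∑-funs-suc xs n f = trans (∑-concatMap (λ v → map (λ x → x VF.∷ v) xs) (funs xs n) f)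
                            (∑-cong (funs xs n) (λ v → ∑-map (λ x → x VF.∷ v) xs f))

  length-funs-suc : (xs : List A) (n : ℕ) → length (funs xs (suc n)) ≡ length (funs xs n) * length xs
  length-funs-suc xs n = begin
    length (funs xs (suc n))                 ≡⟨ ∑-1 (funs xs (suc n)) ⟨
    ∑[ _ ∈ funs xs (suc n) ] 1               ≡⟨ ∑-funs-suc xs n (λ _ → 1) ⟩
    ∑[ v ∈ funs xs n ] ∑[ _ ∈ xs ] 1         ≡⟨ ∑-cong (funs xs n) (λ _ → ∑-1 xs) ⟩
    ∑[ v ∈ funs xs n ] length xs             ≡⟨ ∑-const (funs xs n) (length xs) ⟩
    length (funs xs n) * length xs           ∎
    where open ≡-Reasoning

  length-funs : (xs : List A) (n : ℕ) → length (funs xs n) ≡ length xs ^ n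
  length-funs xs zero    = refl
  length-funs xs (suc n) = begin
    length (funs xs (suc n))                 ≡⟨ length-funs-suc xs n ⟩
    length (funs xs n) * length xs           ≡⟨ cong (_* length xs) (length-funs xs n) ⟩
    length xs ^ n * length xs                ≡⟨ ℕ.*-comm (length xs ^ n) (length xs) ⟩
    length xs ^ suc n                        ∎
    where open ≡-Reasoning

  length-allVecs : ∀ n → length (allVecs n) ≡ p ^ n
  length-allVecs n = trans (length-funs (allFin p) n) (cong (_^ n) (length-tabulate id))

  count-funs-all : {Q : A → Set} (xs : List A) (Q? : Decidable Q) (n : ℕ) →
                   ∑[ v ∈ funs xs n ] 𝟙 (all? (λ i → Q? (v i))) ≡ (∑[ x ∈ xs ] 𝟙 (Q? x)) ^ n
  count-funs-all xs Q? zero    = refl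
  count-funs-all {Q = Q} xs Q? (suc n) = begin
    ∑[ v ∈ funs xs (suc n) ] 𝟙 (all? (Q? ∘ v))                 ≡⟨ ∑-funs-suc xs n _ ⟩
    ∑[ v ∈ funs xs n ] ∑[ x ∈ xs ] 𝟙 (all? (Q? ∘ (x VF.∷ v)))   ≡⟨ ∑-cong (funs xs n) (λ v → ∑-cong xs (split v)) ⟩
    ∑[ v ∈ funs xs n ] ∑[ x ∈ xs ] 𝟙 (Q? x) * 𝟙 (all? (Q? ∘ v))  ≡⟨ ∑-cong (funs xs n) (λ v → ∑-*ʳ xs _ _) ⟩
    ∑[ v ∈ funs xs n ] q * 𝟙 (all? (Q? ∘ v))                    ≡⟨ ∑-*ˡ (funs xs n) _ q ⟩
    q * (∑[ v ∈ funs xs n ] 𝟙 (all? (Q? ∘ v)))                  ≡⟨ cong (q *_) (count-funs-all xs Q? n) ⟩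
    q * q ^ n                                                    ∎
    where
    open ≡-Reasoning
    q = ∑[ x ∈ xs ] 𝟙 (Q? x)
    uncons : ∀ {x v} → (∀ i → Q ((x VF.∷ v) i)) → Q x × (∀ i → Q (v i))
    uncons Q-all = Q-all zero , Q-all ∘ suc
    cons : ∀ {x v} → Q x × (∀ i → Q (v i)) → ∀ i → Q ((x VF.∷ v) i)
    cons (Qx , _)  zero    = Qx
    cons (_  , Qv) (suc i) = Qv i
    split : ∀ v x → 𝟙 (all? (Q? ∘ (x VF.∷ v))) ≡ 𝟙 (Q? x) * 𝟙 (all? (Q? ∘ v))
    split v x = trans (𝟙-cong _ _ uncons cons) (𝟙-× (Q? x) (all? (Q? ∘ v)))

  count-zero : ∀ n → ∑[ v ∈ allVecs n ] 𝟙 (isZero? v) ≡ 1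
  count-zero n = trans (count-funs-all (allFin p) (_≟ 0F) n) (trans (cong (_^ n) (count-allFin 0F)) (ℕ.^-zeroˡ n))

  count-zeroᴹ : ∀ r n → ∑[ u ∈ allMatrices r n ] 𝟙 (isZeroᴹ? u) ≡ 1
  count-zeroᴹ r n = trans (count-funs-all (allVecs n) isZero? r) (trans (cong (_^ r) (count-zero n)) (ℕ.^-zeroˡ r))

  length-allMatrices : ∀ r n → length (allMatrices r n) ≡ p ^ (r * n)
  length-allMatrices r n = begin
    length (allMatrices r n) ≡⟨ length-funs (allVecs n) r ⟩
    length (allVecs n) ^ r   ≡⟨ cong (_^ r) (length-allVecs n) ⟩
    (p ^ n) ^ r              ≡⟨ ℕ.^-*-assoc p n r ⟩
    p ^ (n * r)              ≡⟨ cong (p ^_) (ℕ.*-comm n r) ⟩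
    p ^ (r * n)              ∎
    where open ≡-Reasoning

  slope : ∀ {a b k} → BiAffine a b k → Vec k → Vec a → Vec b
  slope β u x m = (λ l → combo β u l m) · x +F u · (λ j → δ β j m)

  intercept : ∀ {a b k} → BiAffine a b k → Vec k → Vec a → F p
  intercept β u x = u · (λ j → ΣF (λ l → α β j l *F x l) +F c β j)

  ·-eval : ∀ {a b k} (β : BiAffine a b k) (u : Vec k) (x : Vec a) (y : Vec b) →
           u · eval β x y ≡ slope β u x · y +F intercept β u x
  ·-eval β u x y = begin
    u · eval β x y                                  ≡⟨ ·-distribʳ-+F u _ (c β) ⟩
    u · (λ j → Aⱼ j +F Bⱼ j +F Cⱼ j) +F u · c β      ≡⟨ cong (_+F u · c β) (·-distribʳ-+F u _ Cⱼ) ⟩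
    u · (λ j → Aⱼ j +F Bⱼ j) +F u · Cⱼ +F u · c β    ≡⟨ cong (λ s → s +F u · Cⱼ +F u · c β)
                                                           (·-distribʳ-+F u Aⱼ Bⱼ) ⟩
    u · Aⱼ +F u · Bⱼ +F u · Cⱼ +F u · c β            ≡⟨ cong₂ (λ s t → s +F u · Bⱼ +F t +F u · c β) u·A u·C ⟩
    γ-part · y +F u · Bⱼ +F δ-part · y +F u · c β    ≡⟨ regroup (γ-part · y) (u · Bⱼ) (δ-part · y) (u · c β) ⟩
    (γ-part · y +F δ-part · y) +F (u · Bⱼ +F u · c β) ≡⟨ cong₂ _+F_ (·-distribˡ-+F γ-part δ-part y)
                                                                   (·-distribʳ-+F u Bⱼ (c β)) ⟨
    slope β u x · y +F intercept β u x              ∎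
    where
    open ≡-Reasoning
    Aⱼ Bⱼ Cⱼ : Vec _
    Aⱼ j = ΣF (λ l → ΣF (λ m → γ β j l m *F x l *F y m))
    Bⱼ j = ΣF (λ l → α β j l *F x l)
    Cⱼ j = ΣF (λ m → δ β j m *F y m)
    γ-part δ-part : Vec _
    γ-part m = (λ l → combo β u l m) · x
    δ-part m = u · (λ j → δ β j m)
    Aⱼ-transposed : ∀ j → Aⱼ j ≡ (λ m → (λ l → γ β j l m) · x) · y
    Aⱼ-transposed j = trans (ΣF-comm (λ l m → γ β j l m *F x l *F y m))
                            (ΣF-cong (λ m → sym (*F-distribʳ-ΣF (y m) (λ l → γ β j l m *F x l))))
    u·A : u · Aⱼ ≡ γ-part · y
    u·A = begin
      u · Aⱼ                                          ≡⟨ ·-congʳ u Aⱼ-transposed ⟩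
      u · (λ j → (λ m → (λ l → γ β j l m) · x) · y)   ≡⟨ ·-transpose u (λ m j → (λ l → γ β j l m) · x) y ⟩
      (λ m → u · (λ j → (λ l → γ β j l m) · x)) · y   ≡⟨ ·-congˡ y (λ m → ·-transpose u (λ l j → γ β j l m) x) ⟩
      γ-part · y                                      ∎
    u·C : u · Cⱼ ≡ δ-part · y
    u·C = ·-transpose u (λ m j → δ β j m) y
    regroup : ∀ s t v w → s +F t +F v +F w ≡ (s +F v) +F (t +F w)
    regroup s t v w = trans (+F-assoc (s +F t) v w) (+F-interchange s t v w)

module PrimeField (p : ℕ) .{{_ : NonZero p}} (p-prime : Prime p) where
  open Field p
  open Residues p public

  1<p : 1 < p
  1<p = nonTrivial⇒n>1 p {{prime⇒nonTrivial p-prime}}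

  *F-inverse : ∀ x → x ≢ 0F → ∃ λ y → y *F x ≡ 1F
  *F-inverse x x≢0 with coprime-Bézout (prime⇒coprime p-prime {{toℕ-nonZero x≢0}} (Finₚ.toℕ<n x))
  ... | Bézout.-+ a b 1+ap≡bx = reduce b , (begin
    reduce b *F x          ≡⟨ reduce-*-toℕ b x ⟩
    reduce (b * toℕ x)     ≡⟨ cong reduce 1+ap≡bx ⟨
    reduce (1 + a * p)     ≡⟨ reduce-+ 1 (a * p) ⟩
    1F +F reduce (a * p)   ≡⟨ cong (1F +F_) (reduce-*p a) ⟩
    1F +F 0F               ≡⟨ +-identityʳ 1F ⟩
    1F                     ∎)
    where open ≡-Reasoning
  ... | Bézout.+- a b 1+bx≡ap = -F reduce b , (begin
    -F reduce b *F x       ≡⟨ -‿distribˡ-* (reduce b) x ⟨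
    -F (reduce b *F x)     ≡⟨ cong -F_ (+-inverseʳ-unique 1F (reduce b *F x) 1+bx≡0) ⟩
    -F -F 1F               ≡⟨ -‿involutive 1F ⟩
    1F                     ∎)
    where
    open ≡-Reasoning
    1+bx≡0 : 1F +F reduce b *F x ≡ 0F
    1+bx≡0 = begin
      1F +F reduce b *F x          ≡⟨ cong (1F +F_) (reduce-*-toℕ b x) ⟩
      1F +F reduce (b * toℕ x)     ≡⟨ reduce-+ 1 (b * toℕ x) ⟨
      reduce (1 + b * toℕ x)       ≡⟨ cong reduce 1+bx≡ap ⟩
      reduce (a * p)               ≡⟨ reduce-*p a ⟩
      0F                           ∎

  module _ {d : F p} (d≢0 : d ≢ 0F) where

    private
      d⁻¹ = proj₁ (*F-inverse d d≢0)
      d⁻¹d≡1 = proj₂ (*F-inverse d d≢0)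

    quotient : ∀ c → F p
    quotient c = d⁻¹ *F c

    quotient-correct : ∀ c → d *F quotient c ≡ c
    quotient-correct c = begin
      d *F (d⁻¹ *F c)   ≡⟨ *F-assoc d d⁻¹ c ⟨
      (d *F d⁻¹) *F c   ≡⟨ cong (_*F c) (trans (*F-comm d d⁻¹) d⁻¹d≡1) ⟩
      1F *F c           ≡⟨ *F-identityˡ c ⟩
      c                 ∎
      where open ≡-Reasoning

    quotient-unique : ∀ {c e} → d *F e ≡ c → e ≡ quotient c
    quotient-unique {c} {e} de≡c = begin
      e                 ≡⟨ *F-identityˡ e ⟨
      1F *F e           ≡⟨ cong (_*F e) d⁻¹d≡1 ⟨
      (d⁻¹ *F d) *F e   ≡⟨ *F-assoc d⁻¹ d e ⟩
      d⁻¹ *F (d *F e)   ≡⟨ cong (d⁻¹ *F_) de≡c ⟩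
      d⁻¹ *F c          ∎
      where open ≡-Reasoning

  -- Equidistribution

  Equidistributed : {E : Set} → List E → (E → F p) → Set
  Equidistributed xs ψ = ∀ c → (∑[ e ∈ xs ] 𝟙 (ψ e ≟ c)) * p ≡ length xs

  scaling-equidistributed : ∀ {d} → d ≢ 0F → Equidistributed (allFin p) (d *F_)
  scaling-equidistributed {d} d≢0 c = begin
    (∑[ e ∈ allFin p ] 𝟙 (d *F e ≟ c)) * p          ≡⟨ cong (_* p) (∑-cong (allFin p) (λ e →
                                                         𝟙-cong _ _ (quotient-unique d≢0) (λ { refl → quotient-correct d≢0 c }))) ⟩
    (∑[ e ∈ allFin p ] 𝟙 (e ≟ quotient d≢0 c)) * p  ≡⟨ cong (_* p) (count-allFin (quotient d≢0 c)) ⟩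
    1 * p                                           ≡⟨ ℕ.*-identityˡ p ⟩
    p                                               ≡⟨ length-tabulate id ⟨
    length (allFin p)                               ∎
    where open ≡-Reasoning

  -- Conditioned on the other coordinates, the sum is a shift of ψ m.
  ΣF-equidistributed : {E : Set} (xs : List E) {n : ℕ} (ψ : Fin n → E → F p) (m : Fin n) →
                       Equidistributed xs (ψ m) → Equidistributed (funs xs n) (λ y → ΣF (λ i → ψ i (y i)))
  ΣF-equidistributed {E} xs {suc n} ψ m ψₘ-equi c = begin
    (∑[ y ∈ funs xs (suc n) ] 𝟙 (Ψ y ≟ c)) * p   ≡⟨ cong (_* p) (∑-funs-suc xs n _) ⟩
    (∑[ v ∈ funs xs n ] ∑[ x ∈ xs ] 𝟙 (ψ zero x +F Ψ′ v ≟ c)) * p  ≡⟨ split m ψₘ-equi ⟩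
    length (funs xs n) * length xs                ≡⟨ length-funs-suc xs n ⟨
    length (funs xs (suc n))                      ∎
    where
    open ≡-Reasoning
    Ψ : (Fin (suc n) → E) → F p
    Ψ y = ΣF (λ i → ψ i (y i))
    Ψ′ : (Fin n → E) → F p
    Ψ′ v = ΣF (λ i → ψ (suc i) (v i))
    XS = funs xs n

    split : (m : Fin (suc n)) → Equidistributed xs (ψ m) →
            (∑[ v ∈ XS ] ∑[ x ∈ xs ] 𝟙 (ψ zero x +F Ψ′ v ≟ c)) * p ≡ length XS * length xs
    split zero ψ₀-equi = begin
      (∑[ v ∈ XS ] ∑[ x ∈ xs ] 𝟙 (ψ zero x +F Ψ′ v ≟ c)) * p  ≡⟨ ∑-*ʳ XS _ p ⟨
      ∑[ v ∈ XS ] (∑[ x ∈ xs ] 𝟙 (ψ zero x +F Ψ′ v ≟ c)) * p  ≡⟨ ∑-cong XS fibre ⟩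
      ∑[ v ∈ XS ] length xs                                  ≡⟨ ∑-const XS (length xs) ⟩
      length XS * length xs                                  ∎
      where
      fibre : ∀ v → (∑[ x ∈ xs ] 𝟙 (ψ zero x +F Ψ′ v ≟ c)) * p ≡ length xs
      fibre v = trans (cong (_* p) (∑-cong xs (λ x → +F-shift (ψ zero x) (Ψ′ v) c))) (ψ₀-equi (c +F -F Ψ′ v))
    split (suc m) ψₘ-equi = begin
      (∑[ v ∈ XS ] ∑[ x ∈ xs ] 𝟙 (ψ zero x +F Ψ′ v ≟ c)) * p  ≡⟨ cong (_* p) (∑-comm XS xs _) ⟩
      (∑[ x ∈ xs ] ∑[ v ∈ XS ] 𝟙 (ψ zero x +F Ψ′ v ≟ c)) * p  ≡⟨ ∑-*ʳ xs _ p ⟨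
      ∑[ x ∈ xs ] (∑[ v ∈ XS ] 𝟙 (ψ zero x +F Ψ′ v ≟ c)) * p  ≡⟨ ∑-cong xs fibre ⟩
      ∑[ x ∈ xs ] length XS                                  ≡⟨ ∑-const xs (length XS) ⟩
      length xs * length XS                                  ≡⟨ ℕ.*-comm (length xs) (length XS) ⟩
      length XS * length xs                                  ∎
      where
      shift : ∀ x v → 𝟙 (ψ zero x +F Ψ′ v ≟ c) ≡ 𝟙 (Ψ′ v ≟ c +F -F ψ zero x)
      shift x v = trans (cong (λ s → 𝟙 (s ≟ c)) (+F-comm (ψ zero x) (Ψ′ v))) (+F-shift (Ψ′ v) (ψ zero x) c)
      fibre : ∀ x → (∑[ v ∈ XS ] 𝟙 (ψ zero x +F Ψ′ v ≟ c)) * p ≡ length XS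
      fibre x = trans (cong (_* p) (∑-cong XS (shift x)))
                      (ΣF-equidistributed xs (ψ ∘ suc) m ψₘ-equi (c +F -F ψ zero x))

  ·-equidistributed : ∀ {n} {d : Vec n} → ¬ IsZero d → Equidistributed (allVecs n) (d ·_)
  ·-equidistributed {n} {d} d≢0 with Finₚ.¬∀⟶∃¬ n _ (λ j → d j ≟ 0F) d≢0
  ... | j , dⱼ≢0 = ΣF-equidistributed (allFin p) (λ j e → d j *F e) j (scaling-equidistributed dⱼ≢0)

  ⟪⟫-equidistributed : ∀ {r n} {D : Matrix r n} → ¬ IsZeroᴹ D → Equidistributed (allMatrices r n) ⟪ D ,_⟫
  ⟪⟫-equidistributed {r} {D = D} D≢0 with Finₚ.¬∀⟶∃¬ r _ (λ i → isZero? (D i)) D≢0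
  ... | i , Dᵢ≢0 = ΣF-equidistributed (allVecs _) (λ i → D i ·_) i (·-equidistributed Dᵢ≢0)

  -- Systems of bi-affine equations

  module BiAffineSystem {a b k r : ℕ} (β : Fin r → BiAffine a b k) where

    system : Matrix r a → Vec b → Matrix r k
    system x y i = eval (β i) (x i) y

    slopeᴹ : Matrix r k → Matrix r a → Vec b
    slopeᴹ u x m = ΣF (λ i → slope (β i) (u i) (x i) m)

    interceptᴹ : Matrix r k → Matrix r a → F p
    interceptᴹ u x = ΣF (λ i → intercept (β i) (u i) (x i))

    ⟪⟫-system : ∀ u x y → ⟪ u , system x y ⟫ ≡ slopeᴹ u x · y +F interceptᴹ u x
    ⟪⟫-system u x y = begin
      ΣF (λ i → u i · system x y i)           ≡⟨ ΣF-cong (λ i → ·-eval (β i) (u i) (x i) y) ⟩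
      ΣF (λ i → sᵢ i · y +F intercept (β i) (u i) (x i))
                                              ≡⟨ ΣF-distrib-+F (λ i → sᵢ i · y) (λ i → intercept (β i) (u i) (x i)) ⟩
      ΣF (λ i → sᵢ i · y) +F interceptᴹ u x   ≡⟨ cong (_+F interceptᴹ u x) (·-distribˡ-ΣF sᵢ y) ⟨
      slopeᴹ u x · y +F interceptᴹ u x        ∎
      where
      open ≡-Reasoning
      sᵢ : Matrix r b
      sᵢ i = slope (β i) (u i) (x i)

    Degenerate : Matrix r k → Matrix r a → Set
    Degenerate u x = ¬ IsZeroᴹ u × IsZero (slopeᴹ u x)

    degenerate? : ∀ u x → Dec (Degenerate u x)
    degenerate? u x = ¬? (isZeroᴹ? u) ×-dec isZero? (slopeᴹ u x)

    numSolutions-exact : (z : Matrix r k) (x : Matrix r a) → All (λ u → ¬ Degenerate u x) (allMatrices r k) →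
                  numSolutions β z x * p ^ (r * k) ≡ p ^ b
    numSolutions-exact z x nondegenerate = begin
      numSolutions β z x * p ^ (r * k)                                 ≡⟨ cong₂ _*_ (length-filter solves? (allVecs b))
                                                                                    (sym (length-allMatrices r k)) ⟩
      (∑[ y ∈ allVecs b ] 𝟙 (solves? y)) * length (allMatrices r k)     ≡⟨ double-counting p 1<p (allVecs b) (allMatrices r k)
                                                                             P? solves? isZeroᴹ? full-row sparse-row full-column
                                                                             sparse-columns (count-zeroᴹ r k) ⟩
      length (allVecs b)                                                ≡⟨ length-allVecs b ⟩
      p ^ b                                                             ∎
      where
      open ≡-Reasoning
      Solves : Vec b → Set
      Solves y = ∀ i j → system x y i j ≡ z i j
      solves? : ∀ y → Dec (Solves y)
      solves? y = all? (λ i → system x y i ≟V z i)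
      P? : ∀ y u → Dec (⟪ u , system x y ⟫ ≡ ⟪ u , z ⟫)
      P? y u = ⟪ u , system x y ⟫ ≟ ⟪ u , z ⟫

      full-row : ∀ y → Solves y → ∀ u → ⟪ u , system x y ⟫ ≡ ⟪ u , z ⟫
      full-row y s≡z u = ⟪⟫-congʳ u s≡z

      sparse-row : ∀ y → ¬ Solves y → (∑[ u ∈ allMatrices r k ] 𝟙 (P? y u)) * p ≡ length (allMatrices r k)
      sparse-row y s≢z = trans
        (cong (_* p) (∑-cong (allMatrices r k) (λ u → 𝟙-cong (P? y u) (⟪ D , u ⟫ ≟ 0F) (to u) (from u))))
        (⟪⟫-equidistributed D≢0 0F)
        where
        D : Matrix r k
        D i j = system x y i j +F -F z i j
        D≢0 : ¬ IsZeroᴹ D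
        D≢0 D≡0 = s≢z (λ i j → x∙y⁻¹≈ε⇒x≈y _ _ (D≡0 i j))
        to : ∀ u → ⟪ u , system x y ⟫ ≡ ⟪ u , z ⟫ → ⟪ D , u ⟫ ≡ 0F
        to u eq = trans (⟪⟫-comm D u) (trans (⟪⟫-sub u (system x y) z) (x≈y⇒x∙y⁻¹≈ε eq))
        from : ∀ u → ⟪ D , u ⟫ ≡ 0F → ⟪ u , system x y ⟫ ≡ ⟪ u , z ⟫
        from u eq = x∙y⁻¹≈ε⇒x≈y _ _ (trans (sym (⟪⟫-sub u (system x y) z)) (trans (⟪⟫-comm u D) eq))

      full-column : ∀ u → IsZeroᴹ u → ∀ y → ⟪ u , system x y ⟫ ≡ ⟪ u , z ⟫
      full-column u u≡0 y = trans (⟪⟫-zeroˡ (system x y) u≡0) (sym (⟪⟫-zeroˡ z u≡0))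

      sparse-column : ∀ u → ¬ Degenerate u x → ¬ IsZeroᴹ u →
                      (∑[ y ∈ allVecs b ] 𝟙 (P? y u)) * p ≡ length (allVecs b)
      sparse-column u ¬degenerate u≢0 = trans
        (cong (_* p) (∑-cong (allVecs b) (λ y →
          trans (cong (λ v → 𝟙 (v ≟ ⟪ u , z ⟫)) (⟪⟫-system u x y))
                (+F-shift (slopeᴹ u x · y) (interceptᴹ u x) ⟪ u , z ⟫))))
        (·-equidistributed (λ slope≡0 → ¬degenerate (u≢0 , slope≡0)) (⟪ u , z ⟫ +F -F interceptᴹ u x))

      sparse-columns : All (λ u → ¬ IsZeroᴹ u → (∑[ y ∈ allVecs b ] 𝟙 (P? y u)) * p ≡ length (allVecs b))
                           (allMatrices r k)
      sparse-columns = All.map (λ {u} → sparse-column u) nondegenerate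

    module _ {t : ℕ} (u : Matrix r k) (i₀ : Fin r) (s : Fin t → Fin b)
             (independent : ColumnsIndependent (combo (β i₀) (u i₀)) s) where

      restricted-slope : Matrix r a → Vec t
      restricted-slope x q = slopeᴹ u x (s q)

      dual-slope : Vec t → Matrix r a
      dual-slope κ i l = κ · (λ q → combo (β i) (u i) l (s q))

      dual-intercept : Vec t → F p
      dual-intercept κ = ΣF (λ i → κ · (λ q → u i · (λ j → δ (β i) j (s q))))

      ·-restricted-slope : ∀ κ x → κ · restricted-slope x ≡ ⟪ dual-slope κ , x ⟫ +F dual-intercept κ
      ·-restricted-slope κ x = begin
        κ · restricted-slope x                          ≡⟨ ·-distribʳ-ΣF κ (λ i q → Γ i q +F Δ i q) ⟩
        ΣF (λ i → κ · (λ q → Γ i q +F Δ i q))           ≡⟨ ΣF-cong (λ i → ·-distribʳ-+F κ (Γ i) (Δ i)) ⟩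
        ΣF (λ i → κ · Γ i +F κ · Δ i)                   ≡⟨ ΣF-distrib-+F (λ i → κ · Γ i) (λ i → κ · Δ i) ⟩
        ΣF (λ i → κ · Γ i) +F dual-intercept κ          ≡⟨ cong (_+F dual-intercept κ) (ΣF-cong (λ i →
                                                             ·-transpose κ (λ l q → combo (β i) (u i) l (s q)) (x i))) ⟩
        ⟪ dual-slope κ , x ⟫ +F dual-intercept κ        ∎
        where
        open ≡-Reasoning
        Γ Δ : Matrix r t
        Γ i q = (λ l → combo (β i) (u i) l (s q)) · x i
        Δ i q = u i · (λ j → δ (β i) j (s q))

      dual-slope-nonzero : ∀ {κ} → ¬ IsZero κ → ¬ IsZeroᴹ (dual-slope κ)
      dual-slope-nonzero κ≢0 D≡0 = κ≢0 (independent _ (D≡0 i₀))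

      restricted-slope-zeros :
        (∑[ x ∈ allMatrices r a ] 𝟙 (isZero? (restricted-slope x))) * p ^ t ≡ length (allMatrices r a)
      restricted-slope-zeros = trans
        (cong ((∑[ x ∈ allMatrices r a ] 𝟙 (isZero? (restricted-slope x))) *_) (sym (length-allVecs t)))
        (double-counting p 1<p (allMatrices r a) (allVecs t) P? (isZero? ∘ restricted-slope) isZero?
           full-row sparse-row full-column (All.universal sparse-column (allVecs t)) (count-zero t))
        where
        P? : ∀ x κ → Dec (κ · restricted-slope x ≡ 0F)
        P? x κ = κ · restricted-slope x ≟ 0F

        full-row : ∀ x → IsZero (restricted-slope x) → ∀ κ → κ · restricted-slope x ≡ 0F
        full-row x w≡0 κ = ·-zeroʳ κ w≡0

        sparse-row : ∀ x → ¬ IsZero (restricted-slope x) → (∑[ κ ∈ allVecs t ] 𝟙 (P? x κ)) * p ≡ length (allVecs t)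
        sparse-row x w≢0 = trans
          (cong (_* p) (∑-cong (allVecs t) (λ κ → cong (λ v → 𝟙 (v ≟ 0F)) (·-comm κ (restricted-slope x)))))
          (·-equidistributed w≢0 0F)

        full-column : ∀ κ → IsZero κ → ∀ x → κ · restricted-slope x ≡ 0F
        full-column κ κ≡0 x = ·-zeroˡ (restricted-slope x) κ≡0

        sparse-column : ∀ κ → ¬ IsZero κ → (∑[ x ∈ allMatrices r a ] 𝟙 (P? x κ)) * p ≡ length (allMatrices r a)
        sparse-column κ κ≢0 = trans
          (cong (_* p) (∑-cong (allMatrices r a) (λ x →
            trans (cong (λ v → 𝟙 (v ≟ 0F)) (·-restricted-slope κ x)) (+F-shift _ (dual-intercept κ) 0F))))
          (⟪⟫-equidistributed (dual-slope-nonzero κ≢0) (0F +F -F dual-intercept κ))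

    degenerate-count-bound : ∀ {t} → (∀ i → BiAffineRankAtLeast (β i) t) → ∀ u →
                             (∑[ x ∈ allMatrices r a ] 𝟙 (degenerate? u x)) * p ^ t ≤ length (allMatrices r a)
    degenerate-count-bound {t} rank u = bound (isZeroᴹ? u)
      where
      XS = allMatrices r a
      bound : Dec (IsZeroᴹ u) → (∑[ x ∈ XS ] 𝟙 (degenerate? u x)) * p ^ t ≤ length XS
      bound (yes u≡0) = subst (_≤ length XS)
        (sym (cong (_* p ^ t) (∑-zero XS (λ x → 𝟙-false (degenerate? u x) (λ d → proj₁ d u≡0)))))
        z≤n
      bound (no u≢0) with Finₚ.¬∀⟶∃¬ r _ (λ i → isZero? (u i)) u≢0
      ... | i₀ , uᵢ₀≢0 with rank i₀ (u i₀) uᵢ₀≢0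
      ...   | s , independent = ℕ.≤-trans
        (ℕ.*-monoˡ-≤ (p ^ t) (∑-mono XS (λ x →
          𝟙-mono (degenerate? u x) (isZero? (restricted-slope u i₀ s independent x)) (λ d q → proj₂ d (s q)))))
        (ℕ.≤-reflexive (restricted-slope-zeros u i₀ s independent))

    numGood-bound : ∀ (z : Matrix r k) {t} → (∀ i → BiAffineRankAtLeast (β i) t) →
                    length (allMatrices r a) * p ^ t ≤ length (allMatrices r a) * p ^ (r * k) + numGood β z * p ^ t
    numGood-bound z {t} rank = begin
      L * p ^ t                                         ≡⟨ cong (_* p ^ t) (∑-1 XS) ⟨
      (∑[ x ∈ XS ] 1) * p ^ t                           ≤⟨ ℕ.*-monoˡ-≤ (p ^ t) (∑-mono XS covered) ⟩
      (∑[ x ∈ XS ] (𝟙 (good? x) + degeneracy x)) * p ^ t ≡⟨ cong (_* p ^ t) (∑-distrib-+ XS (𝟙 ∘ good?) degeneracy) ⟩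
      (∑ XS (𝟙 ∘ good?) + ∑ XS degeneracy) * p ^ t     ≡⟨ cong (λ g → (g + ∑ XS degeneracy) * p ^ t) (length-filter good? XS) ⟨
      (numGood β z + ∑ XS degeneracy) * p ^ t           ≡⟨ ℕ.*-distribʳ-+ (p ^ t) (numGood β z) (∑ XS degeneracy) ⟩
      numGood β z * p ^ t + ∑ XS degeneracy * p ^ t     ≤⟨ ℕ.+-monoʳ-≤ (numGood β z * p ^ t) total-degeneracy ⟩
      numGood β z * p ^ t + L * p ^ (r * k)             ≡⟨ ℕ.+-comm (numGood β z * p ^ t) (L * p ^ (r * k)) ⟩
      L * p ^ (r * k) + numGood β z * p ^ t             ∎
      where
      open ℕ.≤-Reasoning
      XS = allMatrices r a
      US = allMatrices r k
      L = length XS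

      good? : ∀ x → Dec (numSolutions β z x * p ^ (r * k) ≡ p ^ b)
      good? x = numSolutions β z x * p ^ (r * k) ℕ.≟ p ^ b

      degeneracy : Matrix r a → ℕ
      degeneracy x = ∑[ u ∈ US ] 𝟙 (degenerate? u x)

      covered : ∀ x → 1 ≤ 𝟙 (good? x) + degeneracy x
      covered x with degeneracy x ℕ.≟ 0
      ... | yes none = ℕ.≤-trans (ℕ.≤-reflexive (sym (𝟙-true (good? x) (numSolutions-exact z x nondegenerate))))
                                 (ℕ.m≤m+n (𝟙 (good? x)) (degeneracy x))
        where nondegenerate = All.map (λ {u} → 𝟙≡0⇒¬ (degenerate? u x)) (∑≡0⇒All US _ none)
      ... | no some = ℕ.≤-trans (ℕ.n≢0⇒n>0 some) (ℕ.m≤n+m (degeneracy x) (𝟙 (good? x)))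

      total-degeneracy : ∑ XS degeneracy * p ^ t ≤ L * p ^ (r * k)
      total-degeneracy = begin
        (∑[ x ∈ XS ] ∑[ u ∈ US ] 𝟙 (degenerate? u x)) * p ^ t    ≡⟨ cong (_* p ^ t) (∑-comm XS US _) ⟩
        (∑[ u ∈ US ] ∑[ x ∈ XS ] 𝟙 (degenerate? u x)) * p ^ t    ≡⟨ ∑-*ʳ US _ (p ^ t) ⟨
        ∑[ u ∈ US ] (∑[ x ∈ XS ] 𝟙 (degenerate? u x)) * p ^ t    ≤⟨ ∑-mono US (degenerate-count-bound rank) ⟩
        ∑[ u ∈ US ] L                                            ≡⟨ ∑-const US L ⟩
        length US * L                                            ≡⟨ cong (_* L) (length-allMatrices r k) ⟩
        p ^ (r * k) * L                                          ≡⟨ ℕ.*-comm (p ^ (r * k)) L ⟩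
        L * p ^ (r * k)                                          ∎

open import Data.Integer using (+_; _-_) renaming (_*_ to _*ℤ_; _≤_ to _≤ℤ_)
import Data.Integer as ℤ
import Data.Integer.Properties as ℤₚ
open import Data.Integer.Solver using () renaming (module +-*-Solver to ℤ-Solver)

ℕ-bound⇒ℤ-bound : ∀ L P M G → L * P ≤ L * M + G * P → + L *ℤ (+ P - + M) ≤ℤ + G *ℤ + P
ℕ-bound⇒ℤ-bound L P M G LP≤LM+GP = begin
  + L *ℤ (+ P - + M)                         ≡⟨ solve 3 (λ l p m → l :* (p :- m) := l :* p :- l :* m)
                                                        refl (+ L) (+ P) (+ M) ⟩
  + L *ℤ + P - + L *ℤ + M                    ≤⟨ ℤₚ.+-monoˡ-≤ (ℤ.- (+ L *ℤ + M)) lifted ⟩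
  (+ L *ℤ + M ℤ.+ + G *ℤ + P) - + L *ℤ + M   ≡⟨ solve 3 (λ l m gp → (l :* m :+ gp) :- l :* m := gp)
                                                        refl (+ L) (+ M) (+ G *ℤ + P) ⟩
  + G *ℤ + P                                 ∎
  where
  open ℤₚ.≤-Reasoning
  open ℤ-Solver using (solve; _:+_; _:*_; _:-_; _:=_)
  lifted : + L *ℤ + P ≤ℤ + L *ℤ + M ℤ.+ + G *ℤ + P
  lifted = subst₂ _≤ℤ_ (ℤₚ.pos-* L P)
                  (trans (ℤₚ.pos-+ (L * M) (G * P)) (cong₂ ℤ._+_ (ℤₚ.pos-* L M) (ℤₚ.pos-* G P)))
                  (ℤ.+≤+ LP≤LM+GP)

lemma5p4 : (p : ℕ) .{{_ : NonZero p}} → Prime p →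
    (a b k r t : ℕ) →
    (z : Fin r → Field.Vec p k) →
    (β : Fin r → Field.BiAffine p a b k) →
    (∀ i → Field.BiAffineRankAtLeast p (β i) t) →
    (+ ((p ^ a) ^ r)) *ℤ ((+ (p ^ t)) - (+ (p ^ (r * k))))
      ≤ℤ (+ Field.numGood p β z) *ℤ (+ (p ^ t))
lemma5p4 p p-prime a b k r t z β rank =
  subst (λ L → + L *ℤ (+ p ^ t - + p ^ (r * k)) ≤ℤ + Field.numGood p β z *ℤ + p ^ t)
        |tuples|≡
        (ℕ-bound⇒ℤ-bound (length (allMatrices r a)) (p ^ t) (p ^ (r * k)) (Field.numGood p β z) (BiAffineSystem.numGood-bound β z rank))
  where
  open Field p using (allVecs)
  open PrimeField p p-prime
  |tuples|≡ : length (allMatrices r a) ≡ (p ^ a) ^ r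
  |tuples|≡ = trans (length-funs (allVecs a) r) (cong (_^ r) (length-allVecs a))
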